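{- Let $A$ be an expression of the $\partial\lambda$-calculus with tests and let $A'\in\mathcal T(A)$ be such that $A'\to_h\mathbb B'$ for some sum $\mathbb B'$. Then there exists a sum $\mathbb B$ such that $A\to_h\mathbb B$ and $\mathbb B'\subseteq\mathcal T(\mathbb B)$.
   Context: Syntax of the $\partial\lambda$-calculus with tests. Terms $M,N,L$, bags $P$, tests $V,W$: $M::=x\mid\lambda x.M\mid MP\mid\bar\tau(V)$, $P::=[L_1,\dots,L_k,\mathbb N^{!}]$, $V::=\tau[L_1,\dots,L_k]$ ($k\ge0$), $\mathbb N$ a finite sum of terms; up to $\alpha$-equivalence. Sums are finite formal sums with idempotent addition (identified with finite sets), $0$ the empty sum. $[L_1,\dots,L_k]$ stands for $[L_1,\dots,L_k,0^!]$; bag union $[\vec L,\mathbb N^!]\uplus[\vec L',\mathbb M^!]=[\vec L,\vec L',(\mathbb N+\mathbb M)^!]$. $\varepsilon:=\tau[\,]$, $V\mid W$ multiset union of tests. Constructors are extended to sums multilinearly (constructors applied to $0$ give $0$), except that the promoted component is not distributed. $A\{\mathbb N/x\}$ replaces each free occurrence of $x$ by $\mathbb N$. Linear substitution: $x\langle N/x\rangle=N$, $y\langle N/x\rangle=0$ ($y\ne x$), $(\lambda y.M)\langle N/x\rangle=\lambda y.M\langle N/x\rangle$, $(MP)\langle N/x\rangle=M\langle N/x\rangle P+M(P\langle N/x\rangle)$, $\bar\tau(V)\langle N/x\rangle=\bar\tau(V\langle N/x\rangle)$, $\tau[L_1,\dots,L_k]\langle N/x\rangle=\sum_i\tau[L_1,\dots,L_i\langle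 N/x\rangle,\dots,L_k]$, $[L_1,\dots,L_k,\mathbb N^!]\langle N/x\rangle=\sum_i[L_1,\dots,L_i\langle N/x\rangle,\dots,L_k,\mathbb N^!]+[L_1,\dots,L_k,\mathbb N\langle N/x\rangle,\mathbb N^!]$; $A\langle[L_1,\dots,L_k]/x\rangle:=A\langle L_1/x\rangle\cdots\langle L_k/x\rangle$. Reduction rules: $(\lambda x.M)[L_1,\dots,L_k,\mathbb N^!]\to M\langle[L_1,\dots,L_k]/x\rangle\{\mathbb N/x\}$; $\bar\tau(V)[L_1,\dots,L_k,\mathbb N^!]\to\bar\tau(V)$ if $k=0$, $\to0$ otherwise; $\tau[\lambda x.M]\mid V\to\tau[M\{0/x\}]\mid V$; $\tau[\bar\tau(V)]\mid W\to V\mid W$. Head reduction. A term-redex is a term $(\lambda x.M)P$ or $\bar\tau(V)P$; a test-redex is a test $\tau[\lambda x.M]\mid V$ or $\tau[\bar\tau(V)]\mid W$. Head redexes: every test-redex is a head redex; a term-redex $H$ is a head redex in the term $\lambda y_1\dots y_m.HP_1\cdots P_p$ and in the test $\tau[HP_1\cdots P_p]\mid V$ ($m,p\ge0$). $A\to_h\mathbb B$ is a head-reduction step if $\mathbb B$ is obtained from $A$ by contracting one head redex of $A$ with the rules above; also $A+\mathbb A\to_h\mathbb B+\mathbb A$ then. Taylor expansion: $\mathcal T(x)=\{x\}$; $\mathcal T(\lambda x.M)=\{\lambda x.M':M'\in\mathcal T(M)\}$; $\mathcal T(MP)=\{M'P':M'\in\mathcal T(M),P'\in\mathcal T(P)\}$;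 $\mathcal T(\bar\tau(V))=\{\bar\tau(V'):V'\in\mathcal T(V)\}$; $\mathcal T(\tau[M_1,\dots,M_k])=\{\tau[M'_1,\dots,M'_k]:M'_i\in\mathcal T(M_i)\}$; $\mathcal T([L_1,\dots,L_k,\mathbb N^!])=\{[L'_1,\dots,L'_k]\uplus P:L'_i\in\mathcal T(L_i),\ P\text{ a finite multiset of elements of }\mathcal T(\mathbb N)\}$; $\mathcal T(\sum_iA_i)=\bigcup_i\mathcal T(A_i)$. Its elements are promotion-free expressions (all bags $[L_1,\dots,L_k]$), to which the same rules and head reduction apply. -}

module Defs where

open import Data.Nat using (ℕ; zero; suc; pred; _<ᵇ_; _≡ᵇ_)
open import Data.Bool using (if_then_else_)
open import Data.List using (List; []; _∷_; _++_; _∷ʳ_; map; concatMap; cartesianProductWith)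
open import Data.List.Relation.Unary.All using (All)
open import Data.List.Relation.Unary.Any using (Any)
open import Data.List.Relation.Binary.Pointwise using (Pointwise)
open import Data.List.Relation.Binary.Permutation.Propositional using (_↭_)

-- A sum is a finite list of terms, read as the finite SET of its elements
-- (idempotent addition; 0 = []).  Everything below (Taylor membership,
-- the final inclusion) only depends on sums through list membership.

mutual
  data Term : Set where
    var  : ℕ → Term
    lam  : Term → Term
    app  : Term → Bag → Term
    tbar : Test → Term

  -- [L₁,…,Lₖ, 𝕟^!] : linear part (a multiset, given by a list) and
  -- promoted sum 𝕟
  data Bag : Set where
    bag : List Term → List Term → Bag

  data Test : Set where
    test : List Term → Test

Sum : Set
Sum = List Term

mutual
  shift : ℕ → Term → Term
  shift c (var n)  = var (if n <ᵇ c then n else suc n)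
  shift c (lam M)  = lam (shift (suc c) M)
  shift c (app M P) = app (shift c M) (shiftB c P)
  shift c (tbar V) = tbar (shiftT c V)

  shiftB : ℕ → Bag → Bag
  shiftB c (bag Ls Ns) = bag (shiftL c Ls) (shiftL c Ns)

  shiftT : ℕ → Test → Test
  shiftT c (test Ls) = test (shiftL c Ls)

  shiftL : ℕ → List Term → List Term
  shiftL c []       = []
  shiftL c (M ∷ Ms) = shift c M ∷ shiftL c Ms

combos : {A : Set} → List (List A) → List (List A)
combos []         = [] ∷ []
combos (xs ∷ xss) = cartesianProductWith _∷_ xs (combos xss)

-- Substitution A{𝕟/x} of a sum for the variable with index k; the
-- variable disappears (indices above k are decremented).  Constructors
-- are extended multilinearly, the promoted component is not distributed.

mutual
  nsub : ℕ → Sum → Term → Sum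
  nsub k N (var n)   = if n <ᵇ k then var n ∷ [] else (if n ≡ᵇ k then N else var (pred n) ∷ [])
  nsub k N (lam M)   = map lam (nsub (suc k) (shiftL 0 N) M)
  nsub k N (app M P) = cartesianProductWith app (nsub k N M) (nsubB k N P)
  nsub k N (tbar V)  = map tbar (nsubT k N V)

  nsubB : ℕ → Sum → Bag → List Bag
  nsubB k N (bag Ls Ns) = map (λ Ls' → bag Ls' (nsubSum k N Ns)) (combos (nsubL k N Ls))

  nsubT : ℕ → Sum → Test → List Test
  nsubT k N (test Ls) = map test (combos (nsubL k N Ls))

  nsubL : ℕ → Sum → List Term → List Sum
  nsubL k N []       = []
  nsubL k N (M ∷ Ms) = nsub k N M ∷ nsubL k N Ms

  nsubSum : ℕ → Sum → Sum → Sum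
  nsubSum k N []       = []
  nsubSum k N (M ∷ Ms) = nsub k N M ++ nsubSum k N Ms

-- Linear substitution A⟨N/x⟩ for the variable with index k (the
-- variable stays in scope).

mutual
  lsub : ℕ → Term → Term → Sum
  lsub k N (var n)   = if n ≡ᵇ k then N ∷ [] else []
  lsub k N (lam M)   = map lam (lsub (suc k) (shift 0 N) M)
  lsub k N (app M P) = map (λ m → app m P) (lsub k N M) ++ map (app M) (lsubB k N P)
  lsub k N (tbar V)  = map tbar (lsubT k N V)

  lsubT : ℕ → Term → Test → List Test
  lsubT k N (test Ls) = map test (lsubLs k N Ls)

  lsubB : ℕ → Term → Bag → List Bag
  lsubB k N (bag Ls Ns) =
    map (λ Ls' → bag Ls' Ns) (lsubLs k N Ls)
    ++ map (λ N' → bag (Ls ∷ʳ N') Ns) (lsubSum k N Ns)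

  lsubLs : ℕ → Term → List Term → List (List Term)
  lsubLs k N []       = []
  lsubLs k N (L ∷ Ls) = map (_∷ Ls) (lsub k N L) ++ map (L ∷_) (lsubLs k N Ls)

  lsubSum : ℕ → Term → Sum → Sum
  lsubSum k N []       = []
  lsubSum k N (M ∷ Ms) = lsub k N M ++ lsubSum k N Ms

-- 𝕄⟨[L₁,…,Lₖ]/x⟩ = 𝕄⟨L₁/x⟩⋯⟨Lₖ/x⟩, x = index 0, the Lᵢ living outside x
lsubMany : Sum → List Term → Sum
lsubMany 𝕄 []       = 𝕄
lsubMany 𝕄 (L ∷ Ls) = lsubMany (concatMap (lsub 0 (shift 0 L)) 𝕄) Ls

βred : Term → Bag → Sum
βred M (bag Ls Ns) = concatMap (nsub 0 Ns) (lsubMany (M ∷ []) Ls)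

τred : Test → Bag → Sum
τred V (bag []      Ns) = tbar V ∷ []
τred V (bag (_ ∷ _) Ns) = []

data _→s_ : Term → Sum → Set where
  β-s   : ∀ {M P} → app (lam M) P →s βred M P
  τ-s   : ∀ {V P} → app (tbar V) P →s τred V P
  app-s : ∀ {M P 𝕞} → M →s 𝕞 → app M P →s map (λ m → app m P) 𝕞

data _→h_ : Term → Sum → Set where
  spine-h : ∀ {M 𝕞} → M →s 𝕞 → M →h 𝕞
  lam-h   : ∀ {M 𝕞} → M →h 𝕞 → lam M →h map lam 𝕞

-- head reduction of tests (a test is a multiset; xs, ys are "the rest" V)
data _→ht_ : Test → List Test → Set where
  spine-t : ∀ {xs ys M 𝕣} → M →s 𝕣 →
            test (xs ++ M ∷ ys) →ht map (λ r → test (xs ++ r ∷ ys)) 𝕣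
  lam-t   : ∀ {xs ys M} →
            test (xs ++ lam M ∷ ys) →ht map (λ r → test (xs ++ r ∷ ys)) (nsub 0 [] M)
  tbar-t  : ∀ {xs ys Vs} →
            test (xs ++ tbar (test Vs) ∷ ys) →ht (test (Vs ++ xs ++ ys) ∷ [])

-- Taylor expansion, as membership relations  A' ≺ A  meaning  A' ∈ 𝒯(A).
-- Bags and tests are multisets, hence the permutations.

mutual
  data _≺_ : Term → Term → Set where
    var-≺  : ∀ {n} → var n ≺ var n
    lam-≺  : ∀ {M' M} → M' ≺ M → lam M' ≺ lam M
    app-≺  : ∀ {M' M P' P} → M' ≺ M → P' ≺b P → app M' P' ≺ app M P
    tbar-≺ : ∀ {V' V} → V' ≺t V → tbar V' ≺ tbar V

  data _≺b_ : Bag → Bag → Set where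
    bag-≺ : ∀ {Ls' Ks Qs Ls Ns} → Ls' ↭ (Ks ++ Qs) → Pointwise _≺_ Ks Ls →
            All (λ Q → Any (Q ≺_) Ns) Qs → bag Ls' [] ≺b bag Ls Ns

  data _≺t_ : Test → Test → Set where
    test-≺ : ∀ {Vs' Ws Vs} → Vs' ↭ Ws → Pointwise _≺_ Ws Vs → test Vs' ≺t test Vs

_∈𝒯_ : Term → Sum → Set
M' ∈𝒯 𝔸 = Any (M' ≺_) 𝔸

_∈𝒯t_ : Test → List Test → Set
V' ∈𝒯t 𝕍 = Any (V' ≺t_) 𝕍

module Submission where

-- A head step of an approximant A' ∈ 𝒯(A) contracts an approximant of the head redex of A, so
-- everything reduces to the β-case: (λx.M')[L'₁,…,L'ₙ] ≺ (λx.M)[L₁,…,Lₖ,𝕟^!], where each L'ᵢ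
-- approximates either one of the linear arguments Lⱼ (each of them exactly once) or an element
-- of 𝕟.  Substituting the L'ᵢ into M' yields approximants of M "with debts": the linear
-- arguments whose approximants have been used.  The debts are then settled one at a time on
-- the full side by a linear substitution M⟨Lⱼ/x⟩ (which may linearise an occurrence inside a
-- promoted argument), and once no debt is left, erasing x in the approximant matches
-- substituting 𝕟 for x in the full term.

open import Defs
open import Data.Nat using (ℕ; zero; suc; _<ᵇ_; _≡ᵇ_; _+_)
open import Data.Bool using (true; false; if_then_else_)
open import Data.List using (List; []; _∷_; _++_; _∷ʳ_; map; concatMap)
open import Data.List.Properties using (++-assoc; ++-identityʳ; ++-conicalˡ; ++-conicalʳ)
open import Data.List.Relation.Unary.All using (All; []; _∷_)
import Data.List.Relation.Unary.All as All
import Data.List.Relation.Unary.All.Properties as All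
open import Data.List.Relation.Unary.Any using (Any; here; there)
import Data.List.Relation.Unary.Any as Any
import Data.List.Relation.Unary.Any.Properties as Any
open import Data.List.Relation.Binary.Pointwise using (Pointwise; []; _∷_)
import Data.List.Relation.Binary.Pointwise as Pointwise
open import Data.List.Relation.Binary.Permutation.Propositional
  using (_↭_; prep; swap; ↭-refl; ↭-sym; ↭-trans; ↭-reflexive)
import Data.List.Relation.Binary.Permutation.Propositional as ↭
import Data.List.Relation.Binary.Permutation.Propositional.Properties as ↭
open import Data.List.Membership.Propositional using (_∈_; find; lose)
open import Data.List.Membership.Propositional.Properties
  using (∈-map⁺; ∈-map⁻; ∈-++⁺ˡ; ∈-++⁺ʳ; ∈-++⁻; ∈-∃++; ∈-concatMap⁺; ∈-concatMap⁻;
         ∈-cartesianProductWith⁺; ∈-cartesianProductWith⁻)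
open import Data.Product using (Σ; ∃; ∃₂; _×_; _,_)
open import Function using (_∘_)
open import Data.Sum using (_⊎_; inj₁; inj₂)
open import Data.Empty using (⊥-elim)
open import Relation.Binary.PropositionalEquality
  using (_≡_; refl; sym; cong; cong₂; subst; module ≡-Reasoning)

shiftVar : ℕ → ℕ → ℕ
shiftVar c n = if n <ᵇ c then n else suc n

shiftVar-suc : ∀ c n → shiftVar (suc c) (suc n) ≡ suc (shiftVar c n)
shiftVar-suc c n with n <ᵇ c
... | true  = refl
... | false = refl

shiftVar-comm : ∀ c e n → shiftVar c (shiftVar (c + e) n) ≡ shiftVar (suc (c + e)) (shiftVar c n)
shiftVar-comm zero    e n       = sym (shiftVar-suc e n)
shiftVar-comm (suc c) e zero    = refl
shiftVar-comm (suc c) e (suc n) = begin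
  shiftVar (suc c) (shiftVar (suc (c + e)) (suc n))  ≡⟨ cong (shiftVar (suc c)) (shiftVar-suc (c + e) n) ⟩
  shiftVar (suc c) (suc (shiftVar (c + e) n))        ≡⟨ shiftVar-suc c (shiftVar (c + e) n) ⟩
  suc (shiftVar c (shiftVar (c + e) n))              ≡⟨ cong suc (shiftVar-comm c e n) ⟩
  suc (shiftVar (suc (c + e)) (shiftVar c n))        ≡⟨ sym (shiftVar-suc (suc (c + e)) (shiftVar c n)) ⟩
  shiftVar (suc (suc (c + e))) (suc (shiftVar c n))
    ≡⟨ cong (shiftVar (suc (suc (c + e)))) (sym (shiftVar-suc c n)) ⟩
  shiftVar (suc (suc (c + e))) (shiftVar (suc c) (suc n)) ∎
  where open ≡-Reasoning

<ᵇ-irrefl : ∀ k → (k <ᵇ k) ≡ false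
<ᵇ-irrefl zero    = refl
<ᵇ-irrefl (suc k) = <ᵇ-irrefl k

≡ᵇ-refl : ∀ k → (k ≡ᵇ k) ≡ true
≡ᵇ-refl zero    = refl
≡ᵇ-refl (suc k) = ≡ᵇ-refl k

≡ᵇ-true⇒≡ : ∀ n k → (n ≡ᵇ k) ≡ true → n ≡ k
≡ᵇ-true⇒≡ zero    zero    _ = refl
≡ᵇ-true⇒≡ (suc n) (suc k) e = cong suc (≡ᵇ-true⇒≡ n k e)

<ᵇ⇒≢ᵇ : ∀ n k → (n <ᵇ k) ≡ true → (n ≡ᵇ k) ≡ false
<ᵇ⇒≢ᵇ zero    (suc k) _ = refl
<ᵇ⇒≢ᵇ (suc n) (suc k) e = <ᵇ⇒≢ᵇ n k e

≮ᵇ⇒suc≮ᵇ : ∀ n k → (n <ᵇ k) ≡ false → (suc n <ᵇ k) ≡ false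
≮ᵇ⇒suc≮ᵇ n       zero    _ = refl
≮ᵇ⇒suc≮ᵇ (suc n) (suc k) e = ≮ᵇ⇒suc≮ᵇ n k e

≮ᵇ⇒suc≢ᵇ : ∀ n k → (n <ᵇ k) ≡ false → (suc n ≡ᵇ k) ≡ false
≮ᵇ⇒suc≢ᵇ n       zero    _ = refl
≮ᵇ⇒suc≢ᵇ (suc n) (suc k) e = ≮ᵇ⇒suc≢ᵇ n k e

shiftL≡map : ∀ c Ms → shiftL c Ms ≡ map (shift c) Ms
shiftL≡map c []       = refl
shiftL≡map c (M ∷ Ms) = cong (shift c M ∷_) (shiftL≡map c Ms)

shiftL-++ : ∀ c Ms Ns → shiftL c (Ms ++ Ns) ≡ shiftL c Ms ++ shiftL c Ns
shiftL-++ c []       Ns = refl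
shiftL-++ c (M ∷ Ms) Ns = cong (shift c M ∷_) (shiftL-++ c Ms Ns)

shiftL-↭ : ∀ c {Ms Ns} → Ms ↭ Ns → shiftL c Ms ↭ shiftL c Ns
shiftL-↭ c {Ms} {Ns} π rewrite shiftL≡map c Ms | shiftL≡map c Ns = ↭.map⁺ (shift c) π

∈-shiftL : ∀ c {M Ms} → M ∈ Ms → shift c M ∈ shiftL c Ms
∈-shiftL c {Ms = Ms} m rewrite shiftL≡map c Ms = ∈-map⁺ (shift c) m

mutual
  shift-comm : ∀ c e M → shift c (shift (c + e) M) ≡ shift (suc (c + e)) (shift c M)
  shift-comm c e (var n)   = cong var (shiftVar-comm c e n)
  shift-comm c e (lam M)   = cong lam (shift-comm (suc c) e M)
  shift-comm c e (app M P) = cong₂ app (shift-comm c e M) (shiftB-comm c e P)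
  shift-comm c e (tbar V)  = cong tbar (shiftT-comm c e V)

  shiftB-comm : ∀ c e P → shiftB c (shiftB (c + e) P) ≡ shiftB (suc (c + e)) (shiftB c P)
  shiftB-comm c e (bag Ls Ns) = cong₂ bag (shiftL-comm c e Ls) (shiftL-comm c e Ns)

  shiftT-comm : ∀ c e V → shiftT c (shiftT (c + e) V) ≡ shiftT (suc (c + e)) (shiftT c V)
  shiftT-comm c e (test Ls) = cong test (shiftL-comm c e Ls)

  shiftL-comm : ∀ c e Ms → shiftL c (shiftL (c + e) Ms) ≡ shiftL (suc (c + e)) (shiftL c Ms)
  shiftL-comm c e []       = refl
  shiftL-comm c e (M ∷ Ms) = cong₂ _∷_ (shift-comm c e M) (shiftL-comm c e Ms)

mutual
  lsub-shift : ∀ k X M → lsub k X (shift k M) ≡ []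
  lsub-shift k X (var n) with n <ᵇ k in e
  ... | true  rewrite <ᵇ⇒≢ᵇ n k e = refl
  ... | false rewrite ≮ᵇ⇒suc≢ᵇ n k e = refl
  lsub-shift k X (lam M)   rewrite lsub-shift (suc k) (shift 0 X) M = refl
  lsub-shift k X (app M P) rewrite lsub-shift k X M | lsubB-shift k X P = refl
  lsub-shift k X (tbar V)  rewrite lsubT-shift k X V = refl

  lsubB-shift : ∀ k X P → lsubB k X (shiftB k P) ≡ []
  lsubB-shift k X (bag Ls Ns) rewrite lsubLs-shift k X Ls | lsubSum-shift k X Ns = refl

  lsubT-shift : ∀ k X V → lsubT k X (shiftT k V) ≡ []
  lsubT-shift k X (test Ls) rewrite lsubLs-shift k X Ls = refl

  lsubLs-shift : ∀ k X Ls → lsubLs k X (shiftL k Ls) ≡ []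
  lsubLs-shift k X []       = refl
  lsubLs-shift k X (L ∷ Ls) rewrite lsub-shift k X L | lsubLs-shift k X Ls = refl

  lsubSum-shift : ∀ k X Ms → lsubSum k X (shiftL k Ms) ≡ []
  lsubSum-shift k X []       = refl
  lsubSum-shift k X (M ∷ Ms) rewrite lsub-shift k X M | lsubSum-shift k X Ms = refl

mutual
  nsub-shift : ∀ k N M → nsub k N (shift k M) ≡ M ∷ []
  nsub-shift k N (var n) with n <ᵇ k in e
  ... | true  rewrite e = refl
  ... | false rewrite ≮ᵇ⇒suc≮ᵇ n k e | ≮ᵇ⇒suc≢ᵇ n k e = refl
  nsub-shift k N (lam M)   rewrite nsub-shift (suc k) (shiftL 0 N) M = refl
  nsub-shift k N (app M P) rewrite nsub-shift k N M | nsubB-shift k N P = refl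
  nsub-shift k N (tbar V)  rewrite nsubT-shift k N V = refl

  nsubB-shift : ∀ k N P → nsubB k N (shiftB k P) ≡ P ∷ []
  nsubB-shift k N (bag Ls Ns) rewrite nsubL-shift k N Ls | nsubSum-shift k N Ns = refl

  nsubT-shift : ∀ k N V → nsubT k N (shiftT k V) ≡ V ∷ []
  nsubT-shift k N (test Ls) rewrite nsubL-shift k N Ls = refl

  nsubL-shift : ∀ k N Ls → combos (nsubL k N (shiftL k Ls)) ≡ Ls ∷ []
  nsubL-shift k N []       = refl
  nsubL-shift k N (L ∷ Ls) rewrite nsub-shift k N L | nsubL-shift k N Ls = refl

  nsubSum-shift : ∀ k N Ms → nsubSum k N (shiftL k Ms) ≡ Ms
  nsubSum-shift k N []       = refl
  nsubSum-shift k N (M ∷ Ms) rewrite nsub-shift k N M | nsubSum-shift k N Ms = refl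

mutual
  shift-≺ : ∀ c {M' M} → M' ≺ M → shift c M' ≺ shift c M
  shift-≺ c var-≺       = var-≺
  shift-≺ c (lam-≺ p)   = lam-≺ (shift-≺ (suc c) p)
  shift-≺ c (app-≺ p q) = app-≺ (shift-≺ c p) (shiftB-≺b c q)
  shift-≺ c (tbar-≺ q)  = tbar-≺ (shiftT-≺t c q)

  shiftB-≺b : ∀ c {P' P} → P' ≺b P → shiftB c P' ≺b shiftB c P
  shiftB-≺b c (bag-≺ {Ks = Ks} {Qs} π ps qs) =
    bag-≺ (↭-trans (shiftL-↭ c π) (↭-reflexive (shiftL-++ c Ks Qs))) (shiftL-≺ c ps) (shiftL-≺∈ c qs)

  shiftT-≺t : ∀ c {V' V} → V' ≺t V → shiftT c V' ≺t shiftT c V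
  shiftT-≺t c (test-≺ π ps) = test-≺ (shiftL-↭ c π) (shiftL-≺ c ps)

  shiftL-≺ : ∀ c {Ms' Ms} → Pointwise _≺_ Ms' Ms → Pointwise _≺_ (shiftL c Ms') (shiftL c Ms)
  shiftL-≺ c []       = []
  shiftL-≺ c (p ∷ ps) = shift-≺ c p ∷ shiftL-≺ c ps

  shiftL-≺∈ : ∀ c {Qs Ns} → All (λ Q → Any (Q ≺_) Ns) Qs →
              All (λ Q → Any (Q ≺_) (shiftL c Ns)) (shiftL c Qs)
  shiftL-≺∈ c []       = []
  shiftL-≺∈ c (q ∷ qs) = shift-≺∈ c q ∷ shiftL-≺∈ c qs

  shift-≺∈ : ∀ c {Q Ns} → Any (Q ≺_) Ns → Any (shift c Q ≺_) (shiftL c Ns)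
  shift-≺∈ c (here p)  = here (shift-≺ c p)
  shift-≺∈ c (there q) = there (shift-≺∈ c q)

↭-pick : ∀ {A : Set} {L : A} {R'} R₁ R₂ → R₁ ++ R₂ ↭ L ∷ R' →
         (∃ λ R₁' → R₁ ↭ L ∷ R₁' × R' ↭ R₁' ++ R₂)
         ⊎ (∃ λ R₂' → R₂ ↭ L ∷ R₂' × R' ↭ R₁ ++ R₂')
↭-pick {L = L} R₁ R₂ π with ∈-++⁻ R₁ (↭.∈-resp-↭ (↭-sym π) (here refl))
... | inj₁ L∈R₁ with as , bs , refl ← ∈-∃++ L∈R₁ =
  inj₁ (as ++ bs , ↭.shift L as bs ,
        ↭-trans (↭-sym (↭.drop-mid as [] (↭-trans (↭-reflexive (sym (++-assoc as (L ∷ bs) R₂))) π)))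
                (↭-reflexive (sym (++-assoc as bs R₂))))
... | inj₂ L∈R₂ with as , bs , refl ← ∈-∃++ L∈R₂ =
  inj₂ (as ++ bs , ↭.shift L as bs ,
        ↭-trans (↭-sym (↭.drop-mid (R₁ ++ as) [] (↭-trans (↭-reflexive (++-assoc R₁ as (L ∷ bs))) π)))
                (↭-reflexive (++-assoc R₁ as bs)))

↭-replace : ∀ {A : Set} {x y : A} as bs cs ds →
            as ++ x ∷ bs ↭ cs ++ x ∷ ds → as ++ y ∷ bs ↭ cs ++ y ∷ ds
↭-replace {y = y} as bs cs ds π =
  ↭-trans (↭.shift y as bs) (↭-trans (prep y (↭.drop-mid as cs π)) (↭-sym (↭.shift y cs ds)))

Pointwise-↭ : ∀ {A B : Set} {Q : A → B → Set} {ys xs zs} → Pointwise Q ys xs → xs ↭ zs →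
              ∃ λ ws → ys ↭ ws × Pointwise Q ws zs
Pointwise-↭ qs ↭.refl = _ , ↭-refl , qs
Pointwise-↭ (q ∷ qs) (prep _ π) with ws , ρ , qs' ← Pointwise-↭ qs π = _ , prep _ ρ , q ∷ qs'
Pointwise-↭ (q ∷ q' ∷ qs) (swap _ _ π) with ws , ρ , qs' ← Pointwise-↭ qs π =
  _ , swap _ _ ρ , q' ∷ q ∷ qs'
Pointwise-↭ qs (↭.trans π₁ π₂)
  with ws , ρ , qs' ← Pointwise-↭ qs π₁
  with ws' , ρ' , qs'' ← Pointwise-↭ qs' π₂ =
  ws' , ↭-trans ρ ρ' , qs''

Pointwise-++ʳ⁻ : ∀ {A B : Set} {Q : A → B → Set} {ws} as {bs} → Pointwise Q ws (as ++ bs) →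
                 ∃₂ λ was wbs → ws ≡ was ++ wbs × Pointwise Q was as × Pointwise Q wbs bs
Pointwise-++ʳ⁻ []       qs       = [] , _ , refl , [] , qs
Pointwise-++ʳ⁻ (a ∷ as) (q ∷ qs) with was , wbs , refl , qas , qbs ← Pointwise-++ʳ⁻ as qs =
  _ ∷ was , wbs , refl , q ∷ qas , qbs

Pointwise-midˡ⁻ : ∀ {A B : Set} {Q : A → B → Set} cs {x ds ys} → Pointwise Q (cs ++ x ∷ ds) ys →
                  ∃₂ λ es fs → ∃ λ y →
                    ys ≡ es ++ y ∷ fs × Pointwise Q cs es × Q x y × Pointwise Q ds fs
Pointwise-midˡ⁻ []       (q ∷ qs) = [] , _ , _ , refl , [] , q , qs
Pointwise-midˡ⁻ (c ∷ cs) (q ∷ qs) with es , fs , y , refl , qcs , qx , qds ← Pointwise-midˡ⁻ cs qs =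
  _ ∷ es , fs , y , refl , q ∷ qcs , qx , qds

↭-locate : ∀ {A : Set} {x : A} as bs {ws} → as ++ x ∷ bs ↭ ws →
           ∃₂ λ cs ds → ws ≡ cs ++ x ∷ ds × (∀ y → as ++ y ∷ bs ↭ cs ++ y ∷ ds)
↭-locate as bs π with cs , ds , refl ← ∈-∃++ (↭.∈-resp-↭ π (∈-++⁺ʳ as (here refl))) =
  cs , ds , refl , λ _ → ↭-replace as bs cs ds π

↭-locate-++ : ∀ {A : Set} {x : A} y as bs Ks Qs → as ++ x ∷ bs ↭ Ks ++ Qs →
              (∃₂ λ cs ds → Ks ≡ cs ++ x ∷ ds × as ++ y ∷ bs ↭ (cs ++ y ∷ ds) ++ Qs)
              ⊎ (∃₂ λ cs ds → Qs ≡ cs ++ x ∷ ds × as ++ y ∷ bs ↭ Ks ++ cs ++ y ∷ ds)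
↭-locate-++ {x = x} y as bs Ks Qs π with ∈-++⁻ Ks (↭.∈-resp-↭ π (∈-++⁺ʳ as (here refl)))
... | inj₁ x∈Ks with cs , ds , refl ← ∈-∃++ x∈Ks =
  inj₁ (cs , ds , refl ,
        ↭-trans (↭-replace as bs cs (ds ++ Qs) (↭-trans π (↭-reflexive (++-assoc cs (x ∷ ds) Qs))))
                (↭-reflexive (sym (++-assoc cs (y ∷ ds) Qs))))
... | inj₂ x∈Qs with cs , ds , refl ← ∈-∃++ x∈Qs =
  inj₂ (cs , ds , refl ,
        ↭-trans (↭-replace as bs (Ks ++ cs) ds
                  (↭-trans π (↭-reflexive (sym (++-assoc Ks cs (x ∷ ds))))))
                (↭-reflexive (++-assoc Ks cs (y ∷ ds))))

data Resource (k : ℕ) (S : Sum) : Term → List Term → Set where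
  linear   : ∀ {L' L} → L' ≺ L → Resource k S (shift k L') (shift k L ∷ [])
  promoted : ∀ {Y N} → Y ≺ N → N ∈ S → Resource k S (shift k Y) []

Resource-shift : ∀ {k S X R} → Resource k S X R → Resource (suc k) (shiftL 0 S) (shift 0 X) (shiftL 0 R)
Resource-shift {k} (linear {L'} {L} p) rewrite shift-comm 0 k L' | shift-comm 0 k L = linear (shift-≺ 0 p)
Resource-shift {k} (promoted {Y} p N∈S) rewrite shift-comm 0 k Y = promoted (shift-≺ 0 p) (∈-shiftL 0 N∈S)

lsub-Resource : ∀ {k S X R} Y → Resource k S X R → lsub k Y X ≡ []
lsub-Resource {k} Y (linear {L'} _)   = lsub-shift k Y L'
lsub-Resource {k} Y (promoted {Y'} _ _) = lsub-shift k Y Y'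

-- Approx k S R T M: T is a Taylor approximant of M in which some occurrences of the variable k
-- have been replaced by approximants of elements of S, or by approximants of the linear
-- arguments listed in R (the debts), each of which has to be used exactly once.
mutual
  data Approx (k : ℕ) (S : Sum) : List Term → Term → Term → Set where
    varᵃ  : ∀ {n} → Approx k S [] (var n) (var n)
    resᵃ  : ∀ {X R} → Resource k S X R → Approx k S R X (var k)
    lamᵃ  : ∀ {R T M} → Approx (suc k) (shiftL 0 S) (shiftL 0 R) T M → Approx k S R (lam T) (lam M)
    appᵃ  : ∀ {R₁ R₂ T M P' P} → Approx k S R₁ T M → ApproxBag k S R₂ P' P →
            Approx k S (R₁ ++ R₂) (app T P') (app M P)
    tbarᵃ : ∀ {R V' V} → ApproxTest k S R V' V → Approx k S R (tbar V') (tbar V)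
    perm  : ∀ {R R' T M} → Approx k S R T M → R ↭ R' → Approx k S R' T M

  data ApproxBag (k : ℕ) (S : Sum) : List Term → Bag → Bag → Set where
    bagᵃ : ∀ {Ls' Ks Qs Ls Ns R₁ R₂} → Ls' ↭ Ks ++ Qs →
           ApproxPW k S R₁ Ks Ls → ApproxAll k S R₂ Qs Ns →
           ApproxBag k S (R₁ ++ R₂) (bag Ls' []) (bag Ls Ns)
    perm : ∀ {R R' P' P} → ApproxBag k S R P' P → R ↭ R' → ApproxBag k S R' P' P

  data ApproxTest (k : ℕ) (S : Sum) : List Term → Test → Test → Set where
    testᵃ : ∀ {Vs' Ws Vs R} → Vs' ↭ Ws → ApproxPW k S R Ws Vs → ApproxTest k S R (test Vs') (test Vs)

  data ApproxPW (k : ℕ) (S : Sum) : List Term → List Term → List Term → Set where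
    []   : ApproxPW k S [] [] []
    _∷_  : ∀ {R₁ R₂ T Ts M Ms} → Approx k S R₁ T M → ApproxPW k S R₂ Ts Ms →
           ApproxPW k S (R₁ ++ R₂) (T ∷ Ts) (M ∷ Ms)
    perm : ∀ {R R' Ts Ms} → ApproxPW k S R Ts Ms → R ↭ R' → ApproxPW k S R' Ts Ms

  data ApproxAll (k : ℕ) (S : Sum) : List Term → List Term → List Term → Set where
    []     : ∀ {Ns} → ApproxAll k S [] [] Ns
    _∷⟨_⟩_ : ∀ {R₁ R₂ Q Qs N Ns} → Approx k S R₁ Q N → N ∈ Ns → ApproxAll k S R₂ Qs Ns →
             ApproxAll k S (R₁ ++ R₂) (Q ∷ Qs) Ns
    perm   : ∀ {R R' Qs Ns} → ApproxAll k S R Qs Ns → R ↭ R' → ApproxAll k S R' Qs Ns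

mutual
  ≺⇒Approx : ∀ {k S M' M} → M' ≺ M → Approx k S [] M' M
  ≺⇒Approx var-≺     = varᵃ
  ≺⇒Approx (lam-≺ p) = lamᵃ (≺⇒Approx p)
  ≺⇒Approx (app-≺ p (bag-≺ π ps qs)) =
    appᵃ (≺⇒Approx p) (bagᵃ π (≺⇒ApproxPW ps) (≺∈⇒ApproxAll qs))
  ≺⇒Approx (tbar-≺ (test-≺ π ps)) = tbarᵃ (testᵃ π (≺⇒ApproxPW ps))

  ≺⇒ApproxPW : ∀ {k S Ms' Ms} → Pointwise _≺_ Ms' Ms → ApproxPW k S [] Ms' Ms
  ≺⇒ApproxPW []       = []
  ≺⇒ApproxPW (p ∷ ps) = ≺⇒Approx p ∷ ≺⇒ApproxPW ps

  ≺∈⇒ApproxAll : ∀ {k S Qs Ns} → All (λ Q → Any (Q ≺_) Ns) Qs → ApproxAll k S [] Qs Ns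
  ≺∈⇒ApproxAll []       = []
  ≺∈⇒ApproxAll (q ∷ qs) with _ , N∈Ns , a ← ≺∈⇒Approx q = a ∷⟨ N∈Ns ⟩ ≺∈⇒ApproxAll qs

  ≺∈⇒Approx : ∀ {k S Q Ns} → Any (Q ≺_) Ns → ∃ λ N → N ∈ Ns × Approx k S [] Q N
  ≺∈⇒Approx (here p) = _ , here refl , ≺⇒Approx p
  ≺∈⇒Approx (there q) with N , N∈Ns , a ← ≺∈⇒Approx q = N , there N∈Ns , a

lsubLs⁻ : ∀ k X Ls {Ls'} → Ls' ∈ lsubLs k X Ls →
          ∃₂ λ as bs → ∃₂ λ L L' → Ls ≡ as ++ L ∷ bs × L' ∈ lsub k X L × Ls' ≡ as ++ L' ∷ bs
lsubLs⁻ k X (L ∷ Ls) m with ∈-++⁻ (map (_∷ Ls) (lsub k X L)) m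
... | inj₁ m₁ with L' , L'∈ , refl ← ∈-map⁻ (_∷ Ls) m₁ = [] , Ls , L , L' , refl , L'∈ , refl
... | inj₂ m₂ with Ls₁ , m₃ , refl ← ∈-map⁻ (L ∷_) m₂
              with as , bs , L₀ , L₀' , refl , L₀'∈ , refl ← lsubLs⁻ k X Ls m₃ =
  L ∷ as , bs , L₀ , L₀' , refl , L₀'∈ , refl

mutual
  lsub-approx : ∀ {k S R T M X Rₓ T'} → Approx k S R T M → Resource k S X Rₓ → T' ∈ lsub k X T →
                Approx k S (Rₓ ++ R) T' M
  lsub-approx {k} (varᵃ {n}) r m with n ≡ᵇ k in e
  lsub-approx {k} {Rₓ = Rₓ} (varᵃ {n}) r (here refl) | true rewrite ≡ᵇ-true⇒≡ n k e =
    perm (resᵃ r) (↭-reflexive (sym (++-identityʳ Rₓ)))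
  lsub-approx {X = X} (resᵃ r₀) r m rewrite lsub-Resource X r₀ = ⊥-elim (Any.¬Any[] m)
  lsub-approx {Rₓ = Rₓ} (lamᵃ {R} a) r m with T₁ , m₁ , refl ← ∈-map⁻ lam m =
    lamᵃ (subst (λ R' → Approx _ _ R' T₁ _) (sym (shiftL-++ 0 Rₓ R))
                (lsub-approx a (Resource-shift r) m₁))
  lsub-approx {k} {X = X} {Rₓ} (appᵃ {R₁} {R₂} {T} {P' = P'} a b) r m
    with ∈-++⁻ (map (λ T₁ → app T₁ P') (lsub k X T)) m
  ... | inj₁ m₁ with T₁ , m₂ , refl ← ∈-map⁻ (λ T₁ → app T₁ P') m₁ =
    perm (appᵃ (lsub-approx a r m₂) b) (↭-reflexive (++-assoc Rₓ R₁ R₂))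
  ... | inj₂ m₁ with P₁ , m₂ , refl ← ∈-map⁻ (app T) m₁ =
    perm (appᵃ a (lsubB-approx b r m₂)) (↭.shifts R₁ Rₓ)
  lsub-approx (tbarᵃ t) r m with V₁ , m₁ , refl ← ∈-map⁻ tbar m = tbarᵃ (lsubT-approx t r m₁)
  lsub-approx {Rₓ = Rₓ} (perm a π) r m = perm (lsub-approx a r m) (↭.++⁺ˡ Rₓ π)

  lsubB-approx : ∀ {k S R P' P X Rₓ P''} → ApproxBag k S R P' P → Resource k S X Rₓ →
                 P'' ∈ lsubB k X P' → ApproxBag k S (Rₓ ++ R) P'' P
  lsubB-approx {k} {X = X} {Rₓ} (bagᵃ {Ls'} {Ks} {Qs} {R₁ = R₁} {R₂} π ps qs) r m
    with ∈-++⁻ (map (λ Ls'' → bag Ls'' []) (lsubLs k X Ls')) m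
  ... | inj₁ m₁ with Ls'' , m₂ , refl ← ∈-map⁻ (λ Ls'' → bag Ls'' []) m₁
                with as , bs , L , L' , refl , L'∈ , refl ← lsubLs⁻ k X Ls' m₂
                with ↭-locate-++ L' as bs Ks Qs π
  ...   | inj₁ (cs , ds , refl , σ) =
    perm (bagᵃ σ (lsubPW-approx cs ps r L'∈) qs) (↭-reflexive (++-assoc Rₓ R₁ R₂))
  ...   | inj₂ (cs , ds , refl , σ) =
    perm (bagᵃ σ ps (lsubAll-approx cs qs r L'∈)) (↭.shifts R₁ Rₓ)
  lsubB-approx {Rₓ = Rₓ} (perm b π) r m = perm (lsubB-approx b r m) (↭.++⁺ˡ Rₓ π)

  lsubT-approx : ∀ {k S R V' V X Rₓ V''} → ApproxTest k S R V' V → Resource k S X Rₓ →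
                 V'' ∈ lsubT k X V' → ApproxTest k S (Rₓ ++ R) V'' V
  lsubT-approx {k} {X = X} (testᵃ {Vs'} π ps) r m
    with Vs'' , m₁ , refl ← ∈-map⁻ test m
    with as , bs , L , L' , refl , L'∈ , refl ← lsubLs⁻ k X Vs' m₁
    with cs , ds , refl , σ ← ↭-locate as bs π =
    testᵃ (σ L') (lsubPW-approx cs ps r L'∈)

  lsubPW-approx : ∀ {k S R Ms X Rₓ L L' ds} cs → ApproxPW k S R (cs ++ L ∷ ds) Ms →
                  Resource k S X Rₓ → L' ∈ lsub k X L → ApproxPW k S (Rₓ ++ R) (cs ++ L' ∷ ds) Ms
  lsubPW-approx {Rₓ = Rₓ} []       (_∷_ {R₁} {R₂} a as) r m =
    perm (lsub-approx a r m ∷ as) (↭-reflexive (++-assoc Rₓ R₁ R₂))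
  lsubPW-approx {Rₓ = Rₓ} (c ∷ cs) (_∷_ {R₁} {R₂} a as) r m =
    perm (a ∷ lsubPW-approx cs as r m) (↭.shifts R₁ Rₓ)
  lsubPW-approx {Rₓ = Rₓ} cs       (perm as π)          r m =
    perm (lsubPW-approx cs as r m) (↭.++⁺ˡ Rₓ π)

  lsubAll-approx : ∀ {k S R Ns X Rₓ Q Q' ds} cs → ApproxAll k S R (cs ++ Q ∷ ds) Ns →
                   Resource k S X Rₓ → Q' ∈ lsub k X Q → ApproxAll k S (Rₓ ++ R) (cs ++ Q' ∷ ds) Ns
  lsubAll-approx {Rₓ = Rₓ} []       (_∷⟨_⟩_ {R₁} {R₂} a N∈ as) r m =
    perm (lsub-approx a r m ∷⟨ N∈ ⟩ as) (↭-reflexive (++-assoc Rₓ R₁ R₂))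
  lsubAll-approx {Rₓ = Rₓ} (c ∷ cs) (_∷⟨_⟩_ {R₁} {R₂} a N∈ as) r m =
    perm (a ∷⟨ N∈ ⟩ lsubAll-approx cs as r m) (↭.shifts R₁ Rₓ)
  lsubAll-approx {Rₓ = Rₓ} cs       (perm as π)               r m =
    perm (lsubAll-approx cs as r m) (↭.++⁺ˡ Rₓ π)

∈-lsubSum⁺ : ∀ k L {N N₁ Ns} → N ∈ Ns → N₁ ∈ lsub k L N → N₁ ∈ lsubSum k L Ns
∈-lsubSum⁺ k L {Ns = N ∷ Ns} (here refl) m = ∈-++⁺ˡ m
∈-lsubSum⁺ k L {Ns = N ∷ Ns} (there N∈) m = ∈-++⁺ʳ (lsub k L N) (∈-lsubSum⁺ k L N∈ m)

ApproxPW-∷ʳ : ∀ {k S R Rₙ Ts Ms T M} → ApproxPW k S R Ts Ms → Approx k S Rₙ T M →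
              ApproxPW k S (R ++ Rₙ) (Ts ∷ʳ T) (Ms ∷ʳ M)
ApproxPW-∷ʳ {Rₙ = Rₙ} []                  a = perm (a ∷ []) (↭-reflexive (++-identityʳ Rₙ))
ApproxPW-∷ʳ {Rₙ = Rₙ} (_∷_ {R₁} {R₂} b bs) a =
  perm (b ∷ ApproxPW-∷ʳ bs a) (↭-reflexive (sym (++-assoc R₁ R₂ Rₙ)))
ApproxPW-∷ʳ {Rₙ = Rₙ} (perm bs π)          a = perm (ApproxPW-∷ʳ bs a) (↭.++⁺ʳ Rₙ π)

-- The debt L was incurred inside the promoted approximant Q of N: settling it linearises N into
-- N₁ ∈ N⟨L/x⟩, which moves Q to the linear part of the bag.
record Linearised (k : ℕ) (S : Sum) (L : Term) (R Qs Ns : List Term) : Set where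
  constructor linearised
  field
    Q N N₁     : Term
    Qs₀ R₁ R₂  : List Term
    Qs↭Q∷Qs₀   : Qs ↭ Q ∷ Qs₀
    N∈Ns       : N ∈ Ns
    N₁∈N⟨L⟩    : N₁ ∈ lsub k L N
    approx     : Approx k S R₁ Q N₁
    approxRest : ApproxAll k S R₂ Qs₀ Ns
    R↭R₁++R₂   : R ↭ R₁ ++ R₂

mutual
  settle : ∀ {k S R T M L R'} → Approx k S R T M → R ↭ L ∷ R' →
           ∃ λ M₁ → M₁ ∈ lsub k L M × Approx k S R' T M₁
  settle varᵃ π = ⊥-elim (↭.¬x∷xs↭[] (↭-sym π))
  settle {k} (resᵃ (linear {L = L} p)) π with refl ← ↭.↭-singleton-inv (↭-sym π) rewrite ≡ᵇ-refl k =
    shift k L , here refl , ≺⇒Approx (shift-≺ k p)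
  settle (resᵃ (promoted _ _)) π = ⊥-elim (↭.¬x∷xs↭[] (↭-sym π))
  settle (lamᵃ a) π with M₁ , m , a' ← settle a (shiftL-↭ 0 π) = lam M₁ , ∈-map⁺ lam m , lamᵃ a'
  settle {k} {L = L} (appᵃ {R₁} {R₂} {M = M} {P = P} a b) π with ↭-pick R₁ R₂ π
  ... | inj₁ (_ , π₁ , ρ) with M₁ , m , a' ← settle a π₁ =
    app M₁ P , ∈-++⁺ˡ (∈-map⁺ (λ M₁ → app M₁ P) m) , perm (appᵃ a' b) (↭-sym ρ)
  ... | inj₂ (_ , π₂ , ρ) with P₁ , m , b' ← settleB b π₂ =
    app M P₁ , ∈-++⁺ʳ (map (λ M₁ → app M₁ P) (lsub k L M)) (∈-map⁺ (app M) m) ,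
    perm (appᵃ a b') (↭-sym ρ)
  settle (tbarᵃ t) π with V₁ , m , t' ← settleT t π = tbar V₁ , ∈-map⁺ tbar m , tbarᵃ t'
  settle (perm a π') π = settle a (↭-trans π' π)

  settleB : ∀ {k S R P' P L R'} → ApproxBag k S R P' P → R ↭ L ∷ R' →
            ∃ λ P₁ → P₁ ∈ lsubB k L P × ApproxBag k S R' P' P₁
  settleB {k} {L = L} (bagᵃ {Ks = Ks} {Ls = Ls} {Ns} {R₁} {R₂} σ ps qs) π with ↭-pick R₁ R₂ π
  ... | inj₁ (_ , π₁ , ρ) with Ls₁ , m , ps' ← settlePW ps π₁ =
    bag Ls₁ Ns , ∈-++⁺ˡ (∈-map⁺ (λ Ls₁ → bag Ls₁ Ns) m) , perm (bagᵃ σ ps' qs) (↭-sym ρ)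
  ... | inj₂ (_ , π₂ , ρ) with linearised Q N N₁ Qs₀ Ra Rb τ N∈ N₁∈ a qs' ρ' ← settleAll qs π₂ =
    bag (Ls ∷ʳ N₁) Ns ,
    ∈-++⁺ʳ (map (λ Ls₁ → bag Ls₁ Ns) (lsubLs k L Ls))
           (∈-map⁺ (λ N' → bag (Ls ∷ʳ N') Ns) (∈-lsubSum⁺ k L N∈ N₁∈)) ,
    perm (bagᵃ (↭-trans σ (↭-trans (↭.++⁺ˡ Ks τ) (↭-reflexive (sym (++-assoc Ks (Q ∷ []) Qs₀)))))
               (ApproxPW-∷ʳ ps a) qs')
         (↭-sym (↭-trans ρ (↭-trans (↭.++⁺ˡ R₁ ρ') (↭-reflexive (sym (++-assoc R₁ Ra Rb))))))
  settleB (perm b π') π = settleB b (↭-trans π' π)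

  settleT : ∀ {k S R V' V L R'} → ApproxTest k S R V' V → R ↭ L ∷ R' →
            ∃ λ V₁ → V₁ ∈ lsubT k L V × ApproxTest k S R' V' V₁
  settleT (testᵃ σ ps) π with Vs₁ , m , ps' ← settlePW ps π = test Vs₁ , ∈-map⁺ test m , testᵃ σ ps'

  settlePW : ∀ {k S R Ts Ms L R'} → ApproxPW k S R Ts Ms → R ↭ L ∷ R' →
             ∃ λ Ms₁ → Ms₁ ∈ lsubLs k L Ms × ApproxPW k S R' Ts Ms₁
  settlePW [] π = ⊥-elim (↭.¬x∷xs↭[] (↭-sym π))
  settlePW {k} {L = L} (_∷_ {R₁} {R₂} {M = M} {Ms} a as) π with ↭-pick R₁ R₂ π
  ... | inj₁ (_ , π₁ , ρ) with M₁ , m , a' ← settle a π₁ =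
    M₁ ∷ Ms , ∈-++⁺ˡ (∈-map⁺ (_∷ Ms) m) , perm (a' ∷ as) (↭-sym ρ)
  ... | inj₂ (_ , π₂ , ρ) with Ms₁ , m , as' ← settlePW as π₂ =
    M ∷ Ms₁ , ∈-++⁺ʳ (map (_∷ Ms) (lsub k L M)) (∈-map⁺ (M ∷_) m) , perm (a ∷ as') (↭-sym ρ)
  settlePW (perm as π') π = settlePW as (↭-trans π' π)

  settleAll : ∀ {k S R Qs Ns L R'} → ApproxAll k S R Qs Ns → R ↭ L ∷ R' → Linearised k S L R' Qs Ns
  settleAll [] π = ⊥-elim (↭.¬x∷xs↭[] (↭-sym π))
  settleAll (_∷⟨_⟩_ {R₁} {R₂} {Q} {Qs} a N∈ as) π with ↭-pick R₁ R₂ π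
  ... | inj₁ (R₁' , π₁ , ρ) with N₁ , m , a' ← settle a π₁ =
    linearised Q _ N₁ Qs R₁' R₂ ↭-refl N∈ m a' as ρ
  ... | inj₂ (_ , π₂ , ρ) with linearised Q₀ N N₁ Qs₀ Ra Rb τ N∈' m a' as' ρ' ← settleAll as π₂ =
    linearised Q₀ N N₁ (Q ∷ Qs₀) Ra (R₁ ++ Rb) (↭-trans (prep Q τ) (swap Q Q₀ ↭-refl))
               N∈' m a' (a ∷⟨ N∈ ⟩ as')
               (↭-trans ρ (↭-trans (↭.++⁺ˡ R₁ ρ') (↭.shifts R₁ Ra)))
  settleAll (perm as π') π = settleAll as (↭-trans π' π)

combos-nsubL⁻ : ∀ k N Ms {Ms'} → Ms' ∈ combos (nsubL k N Ms) → Pointwise (λ M' M → M' ∈ nsub k N M) Ms' Ms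
combos-nsubL⁻ k N []       (here refl) = []
combos-nsubL⁻ k N (M ∷ Ms) m
  with M' , Ms' , M'∈ , Ms'∈ , refl ← ∈-cartesianProductWith⁻ _∷_ (nsub k N M) (combos (nsubL k N Ms)) m =
  M'∈ ∷ combos-nsubL⁻ k N Ms Ms'∈

Any-nsubSum⁺ : ∀ k S {N Ns} {P : Term → Set} → N ∈ Ns → Any P (nsub k S N) → Any P (nsubSum k S Ns)
Any-nsubSum⁺ k S {Ns = N ∷ Ns} (here refl) p = Any.++⁺ˡ p
Any-nsubSum⁺ k S {Ns = N ∷ Ns} (there N∈)  p = Any.++⁺ʳ (nsub k S N) (Any-nsubSum⁺ k S N∈ p)

mutual
  nsub-approx : ∀ {k S R T M T₀} → Approx k S R T M → R ≡ [] → T₀ ∈ nsub k [] T → Any (T₀ ≺_) (nsub k S M)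
  nsub-approx {k} (varᵃ {n}) _ m with n <ᵇ k
  ... | true with here refl ← m = here var-≺
  ... | false with n ≡ᵇ k
  ...   | false with here refl ← m = here var-≺
  nsub-approx {k} (resᵃ (promoted {Y} p N∈S)) refl m rewrite nsub-shift k [] Y | <ᵇ-irrefl k | ≡ᵇ-refl k
    with here refl ← m = lose N∈S p
  nsub-approx (lamᵃ a) refl m with T₁ , m₁ , refl ← ∈-map⁻ lam m =
    Any.map⁺ (Any.map lam-≺ (nsub-approx a refl m₁))
  nsub-approx {k} (appᵃ {R₁} {R₂} {T} {P' = P'} a b) e m
    with T₁ , P₁ , m₁ , m₂ , refl ← ∈-cartesianProductWith⁻ app (nsub k [] T) (nsubB k [] P') m
    with M₁ , M₁∈ , p ← find (nsub-approx a (++-conicalˡ R₁ R₂ e) m₁)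
    with Q₁ , Q₁∈ , q ← find (nsubB-approx b (++-conicalʳ R₁ R₂ e) m₂) =
    lose (∈-cartesianProductWith⁺ app M₁∈ Q₁∈) (app-≺ p q)
  nsub-approx (tbarᵃ t) e m with V₁ , m₁ , refl ← ∈-map⁻ tbar m =
    Any.map⁺ (Any.map tbar-≺ (nsubT-approx t e m₁))
  nsub-approx (perm a π) refl m = nsub-approx a (↭.↭-empty-inv π) m

  nsubB-approx : ∀ {k S R P' P P₀} → ApproxBag k S R P' P → R ≡ [] → P₀ ∈ nsubB k [] P' →
                 Any (P₀ ≺b_) (nsubB k S P)
  nsubB-approx {k} {S} (bagᵃ {Ls'} {Ks} {Ns = Ns} {R₁} {R₂} σ ps qs) e m
    with Ls'' , m₁ , refl ← ∈-map⁻ (λ Ls'' → bag Ls'' []) m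
    with ws , τ , ws∈ ← Pointwise-↭ (combos-nsubL⁻ k [] Ls' m₁) σ
    with wKs , wQs , refl , wKs∈ , wQs∈ ← Pointwise-++ʳ⁻ Ks ws∈
    with Ls₃ , Ls₃∈ , ps₃ ← nsubPW-approx ps (++-conicalˡ R₁ R₂ e) wKs∈ =
    lose (∈-map⁺ (λ Ls₃ → bag Ls₃ (nsubSum k S Ns)) Ls₃∈)
         (bag-≺ τ ps₃ (nsubAll-approx qs (++-conicalʳ R₁ R₂ e) wQs∈))
  nsubB-approx (perm b π) refl m = nsubB-approx b (↭.↭-empty-inv π) m

  nsubT-approx : ∀ {k S R V' V V₀} → ApproxTest k S R V' V → R ≡ [] → V₀ ∈ nsubT k [] V' →
                 Any (V₀ ≺t_) (nsubT k S V)
  nsubT-approx {k} (testᵃ {Vs'} σ ps) e m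
    with Vs'' , m₁ , refl ← ∈-map⁻ test m
    with ws , τ , ws∈ ← Pointwise-↭ (combos-nsubL⁻ k [] Vs' m₁) σ
    with Vs₃ , Vs₃∈ , ps₃ ← nsubPW-approx ps e ws∈ =
    lose (∈-map⁺ test Vs₃∈) (test-≺ τ ps₃)

  nsubPW-approx : ∀ {k S R Ts Ms Ts₀} → ApproxPW k S R Ts Ms → R ≡ [] →
                  Pointwise (λ T₀ T → T₀ ∈ nsub k [] T) Ts₀ Ts →
                  ∃ λ Ms₀ → Ms₀ ∈ combos (nsubL k S Ms) × Pointwise _≺_ Ts₀ Ms₀
  nsubPW-approx [] _ [] = [] , here refl , []
  nsubPW-approx (_∷_ {R₁} {R₂} a as) e (w ∷ ws)
    with M₀ , M₀∈ , p ← find (nsub-approx a (++-conicalˡ R₁ R₂ e) w)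
    with Ms₀ , Ms₀∈ , ps ← nsubPW-approx as (++-conicalʳ R₁ R₂ e) ws =
    M₀ ∷ Ms₀ , ∈-cartesianProductWith⁺ _∷_ M₀∈ Ms₀∈ , p ∷ ps
  nsubPW-approx (perm as π) refl ws = nsubPW-approx as (↭.↭-empty-inv π) ws

  nsubAll-approx : ∀ {k S R Qs Ns Qs₀} → ApproxAll k S R Qs Ns → R ≡ [] →
                   Pointwise (λ Q₀ Q → Q₀ ∈ nsub k [] Q) Qs₀ Qs →
                   All (λ Q₀ → Any (Q₀ ≺_) (nsubSum k S Ns)) Qs₀
  nsubAll-approx [] _ [] = []
  nsubAll-approx {k} {S} (_∷⟨_⟩_ {R₁} {R₂} a N∈ as) e (w ∷ ws) =
    Any-nsubSum⁺ k S N∈ (nsub-approx a (++-conicalˡ R₁ R₂ e) w)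
    ∷ nsubAll-approx as (++-conicalʳ R₁ R₂ e) ws
  nsubAll-approx (perm as π) refl ws = nsubAll-approx as (↭.↭-empty-inv π) ws

_⊆𝒯_ : Sum → Sum → Set
𝔹' ⊆𝒯 𝔹 = All (_∈𝒯 𝔹) 𝔹'

_⊆𝒯t_ : List Test → List Test → Set
𝕍' ⊆𝒯t 𝕍 = All (_∈𝒯t 𝕍) 𝕍'

data Resources (S : Sum) : List Term → List Term → Set where
  []  : Resources S [] []
  _∷_ : ∀ {L R Ls Rs} → Resource 0 S (shift 0 L) R → Resources S Ls Rs → Resources S (L ∷ Ls) (R ++ Rs)

Resources-↭ : ∀ {S Ls Ls' R} → Ls ↭ Ls' → Resources S Ls R → ∃ λ R' → Resources S Ls' R' × R' ↭ R
Resources-↭ ↭.refl rs = _ , rs , ↭-refl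
Resources-↭ (prep _ π) (_∷_ {R = R} r rs) with R' , rs' , ρ ← Resources-↭ π rs = R ++ R' , r ∷ rs' , ↭.++⁺ˡ R ρ
Resources-↭ (swap _ _ π) (_∷_ {R = R} r (_∷_ {R = R'} r' rs)) with R'' , rs' , ρ ← Resources-↭ π rs =
  R' ++ R ++ R'' , r' ∷ (r ∷ rs') , ↭-trans (↭.shifts R' R) (↭.++⁺ˡ R (↭.++⁺ˡ R' ρ))
Resources-↭ (↭.trans π₁ π₂) rs
  with R₁ , rs₁ , ρ₁ ← Resources-↭ π₁ rs
  with R₂ , rs₂ , ρ₂ ← Resources-↭ π₂ rs₁ =
  R₂ , rs₂ , ↭-trans ρ₂ ρ₁

Resources-++ : ∀ {S Ls Ls' R R'} → Resources S Ls R → Resources S Ls' R' → Resources S (Ls ++ Ls') (R ++ R')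
Resources-++ [] rs' = rs'
Resources-++ {R' = R'} (_∷_ {R = R} {Rs = Rs} r rs) rs' =
  subst (Resources _ _) (sym (++-assoc R Rs R')) (r ∷ Resources-++ rs rs')

linearResources : ∀ {S Ks Ls} → Pointwise _≺_ Ks Ls → Resources S Ks (shiftL 0 Ls)
linearResources []       = []
linearResources (p ∷ ps) = linear p ∷ linearResources ps

promotedResources : ∀ {S Qs} → All (λ Q → Any (Q ≺_) S) Qs → Resources S Qs []
promotedResources []       = []
promotedResources (q ∷ qs) with N , N∈S , p ← find q = promoted p N∈S ∷ promotedResources qs

lsubMany-approx : ∀ {S M Ls R R₀ 𝕋} → Resources S Ls R → (∀ {T} → T ∈ 𝕋 → Approx 0 S R₀ T M) →
                  ∀ {T} → T ∈ lsubMany 𝕋 Ls → Approx 0 S (R ++ R₀) T M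
lsubMany-approx [] a m = a m
lsubMany-approx {R₀ = R₀} {𝕋} (_∷_ {L} {R} {Rs = Rs} r rs) a m =
  perm (lsubMany-approx rs a' m) (↭-trans (↭.shifts Rs R) (↭-reflexive (sym (++-assoc R Rs R₀))))
  where
    a' : ∀ {T} → T ∈ concatMap (lsub 0 (shift 0 L)) 𝕋 → Approx 0 _ (R ++ R₀) T _
    a' m' with T₀ , T₀∈ , m'' ← find (∈-concatMap⁻ (lsub 0 (shift 0 L)) {xs = 𝕋} m') =
      lsub-approx (a T₀∈) r m''

settleMany : ∀ {S R T M 𝕄} Ls → Approx 0 S R T M → R ↭ shiftL 0 Ls → M ∈ 𝕄 →
             ∃ λ M₀ → M₀ ∈ lsubMany 𝕄 Ls × Approx 0 S [] T M₀
settleMany []       a π M∈ = _ , M∈ , perm a π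
settleMany {𝕄 = 𝕄} (L ∷ Ls) a π M∈ with M₁ , M₁∈ , a₁ ← settle a π =
  settleMany Ls a₁ ↭-refl (∈-concatMap⁺ (lsub 0 (shift 0 L)) {xs = 𝕄} (lose M∈ M₁∈))

βred-⊆𝒯 : ∀ {M' M Ls' Ls Ns} → M' ≺ M → bag Ls' [] ≺b bag Ls Ns → βred M' (bag Ls' []) ⊆𝒯 βred M (bag Ls Ns)
βred-⊆𝒯 {M'} {M} {Ls'} {Ls} {Ns} p (bag-≺ π ps qs) = All.tabulate reduct-≺
  where
    reduct-≺ : ∀ {B'} → B' ∈ βred M' (bag Ls' []) → B' ∈𝒯 βred M (bag Ls Ns)
    reduct-≺ m
      with T , T∈ , B'∈ ← find (∈-concatMap⁻ (nsub 0 []) {xs = lsubMany (M' ∷ []) Ls'} m)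
      with R , rs , ρ ← Resources-↭ (↭-sym π) (Resources-++ (linearResources ps) (promotedResources qs))
      with M₀ , M₀∈ , a ← settleMany Ls (lsubMany-approx rs (λ { (here refl) → ≺⇒Approx p }) T∈)
                                       (↭-trans (↭.++-identityʳ R) (↭-trans ρ (↭.++-identityʳ _)))
                                       (here refl) =
      Any.concatMap⁺ (nsub 0 Ns) (lose M₀∈ (nsub-approx a refl B'∈))

All-Any-map : ∀ {A B C D : Set} {_∼₁_ : A → B → Set} {_∼₂_ : C → D → Set} (f : A → C) (g : B → D) →
              (∀ {a b} → a ∼₁ b → f a ∼₂ g b) → ∀ {as bs} →
              All (λ a → Any (a ∼₁_) bs) as → All (λ c → Any (c ∼₂_) (map g bs)) (map f as)
All-Any-map f g h = All.map⁺ ∘ All.map (Any.map⁺ ∘ Any.map h)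

→s-simulation : ∀ {A A' 𝔹'} → A' ≺ A → A' →s 𝔹' → ∃ λ 𝔹 → A →s 𝔹 × 𝔹' ⊆𝒯 𝔹
→s-simulation (app-≺ (lam-≺ p) q@(bag-≺ _ _ _)) β-s = _ , β-s , βred-⊆𝒯 p q
→s-simulation (app-≺ (tbar-≺ q) (bag-≺ {[]} {Ks} {Qs} π ps _)) τ-s
  with refl ← ++-conicalˡ Ks Qs (↭.↭-empty-inv (↭-sym π)) with [] ← ps = _ , τ-s , here (tbar-≺ q) ∷ []
→s-simulation (app-≺ (tbar-≺ q) (bag-≺ {_ ∷ _} _ _ _)) τ-s = _ , τ-s , []
→s-simulation (app-≺ {P' = P'} {P} p q) (app-s s) with 𝔹 , s' , ⊆ ← →s-simulation p s =
  _ , app-s s' , All-Any-map (λ M → app M P') (λ M → app M P) (λ p' → app-≺ p' q) ⊆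

→h-simulation : ∀ {A A' 𝔹'} → A' ≺ A → A' →h 𝔹' → ∃ λ 𝔹 → A →h 𝔹 × 𝔹' ⊆𝒯 𝔹
→h-simulation p (spine-h s) with 𝔹 , s' , ⊆ ← →s-simulation p s = 𝔹 , spine-h s' , ⊆
→h-simulation (lam-≺ p) (lam-h h) with 𝔹 , h' , ⊆ ← →h-simulation p h =
  _ , lam-h h' , All-Any-map lam lam lam-≺ ⊆

≺t-++ : ∀ {Vs' Vs Ws' Ws} → test Vs' ≺t test Vs → test Ws' ≺t test Ws → test (Vs' ++ Ws') ≺t test (Vs ++ Ws)
≺t-++ (test-≺ π ps) (test-≺ σ qs) = test-≺ (↭.++⁺ π σ) (Pointwise.++⁺ ps qs)

≺t-focus : ∀ {xs M' ys Vs} → test (xs ++ M' ∷ ys) ≺t test Vs →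
           ∃₂ λ es fs → ∃ λ M → Vs ≡ es ++ M ∷ fs × M' ≺ M ×
             (∀ {N' N} → N' ≺ N → test (xs ++ N' ∷ ys) ≺t test (es ++ N ∷ fs)) ×
             test (xs ++ ys) ≺t test (es ++ fs)
≺t-focus {xs} {ys = ys} (test-≺ π ps)
  with cs , ds , refl , σ ← ↭-locate xs ys π
  with es , fs , M , refl , pcs , p , pds ← Pointwise-midˡ⁻ cs ps =
  es , fs , M , refl , p , (λ q → test-≺ (σ _) (Pointwise.++⁺ pcs (q ∷ pds))) ,
  test-≺ (↭.drop-mid xs cs π) (Pointwise.++⁺ pcs pds)

→ht-simulation : ∀ {A A' 𝔹'} → A' ≺t A → A' →ht 𝔹' → ∃ λ 𝔹 → A →ht 𝔹 × 𝔹' ⊆𝒯t 𝔹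
→ht-simulation {test _} p (spine-t {xs} {ys} s)
  with es , fs , M , refl , q , focus , _ ← ≺t-focus p
  with 𝕣 , s' , ⊆ ← →s-simulation q s =
  _ , spine-t s' , All-Any-map (λ r → test (xs ++ r ∷ ys)) (λ r → test (es ++ r ∷ fs)) focus ⊆
→ht-simulation {test _} p (lam-t {xs} {ys})
  with es , fs , lam M , refl , lam-≺ q , focus , _ ← ≺t-focus p =
  _ , lam-t , All-Any-map (λ r → test (xs ++ r ∷ ys)) (λ r → test (es ++ r ∷ fs)) focus
                (All.tabulate (nsub-approx (≺⇒Approx q) refl))
→ht-simulation {test _} p tbar-t
  with es , fs , tbar (test Vs) , refl , tbar-≺ q , _ , rest ← ≺t-focus p =
  _ , tbar-t , here (≺t-++ q rest) ∷ []

proposition8p6 :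
    ((A A' : Term) (𝔹' : Sum) → A' ≺ A → A' →h 𝔹' →
      Σ Sum (λ 𝔹 → (A →h 𝔹) × All (λ B' → B' ∈𝒯 𝔹) 𝔹'))
    ×
    ((A A' : Test) (𝔹' : List Test) → A' ≺t A → A' →ht 𝔹' →
      Σ (List Test) (λ 𝔹 → (A →ht 𝔹) × All (λ B' → B' ∈𝒯t 𝔹) 𝔹'))
proposition8p6 = (λ _ _ _ → →h-simulation) , (λ _ _ _ → →ht-simulation)
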